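{- Let $n\ge4$ and $k\ge1$ be integers. Then \[ \gamma_{[k]R}(C_8\Box P_n)\le 8(n-2)\left\lceil\frac{k+4}{5}\right\rceil+16\left\lceil\frac{k+3-\left\lceil\frac{k+4}{5}\right\rceil}{3}\right\rceil . \]
   Context: For a graph $G$ and $v\in V(G)$, $N(v)$ is the open neighborhood and $N[v]=N(v)\cup\{v\}$. For an integer $k\ge1$, a function $f:V(G)\to\{0,1,\dots,k+1\}$ is a $[k]$-Roman dominating function if for every vertex $v$ with $f(v)<k$ we have $\sum_{u\in N[v]}f(u)\ge k+|\{u\in N(v): f(u)>0\}|$. The weight of $f$ is $\sum_{v}f(v)$, and $\gamma_{[k]R}(G)$ is the minimum weight of a $[k]$-Roman dominating function on $G$. $C_m\Box P_n$ is the Cartesian product of the cycle $C_m$ (vertices $0,\dots,m-1$ mod $m$) and the path $P_n$ (vertices $0,\dots,n-1$): $(i,j)\sim(i',j')$ iff ($i=i'$ and $|j-j'|=1$) or ($j=j'$ and $i'\equiv i\pm1 \pmod m$). -}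

module Defs where

open import Data.Nat using (ℕ; zero; suc; _+_; _*_; _∸_; _≤_; _<_; NonZero)
open import Data.Nat.DivMod using (_/_; _%_)
open import Data.List using (List; []; _∷_; _++_; map; filter; upTo; concatMap)
open import Data.Nat.ListAction using (sum)
open import Data.Product using (_×_; _,_; Σ; ∃)
open import Data.Nat.Properties using (_<?_)
open import Relation.Nullary using (yes; no)

⌈_/_⌉ : (a b : ℕ) → .{{NonZero b}} → ℕ
⌈ a / b ⌉ = (a + b ∸ 1) / b

-- Vertices of C_m □ P_n are pairs (i , j) of naturals with i < m, j < n.
-- The cycle coordinate i is taken mod m, the path coordinate j in 0..n-1.
Vertex : Set
Vertex = ℕ × ℕ

vertices : ℕ → ℕ → List Vertex
vertices m n = concatMap (λ i → map (λ j → (i , j)) (upTo n)) (upTo m)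

-- the open neighbourhood N((i,j)) in C_m □ P_n, for m ≥ 3 (so the two cycle
-- neighbours are distinct from each other and from (i,j))
nbrs : (m n : ℕ) → .{{NonZero m}} → Vertex → List Vertex
nbrs m n (i , j) =
  ((suc i) % m , j) ∷ ((i + m ∸ 1) % m , j) ∷ (pathDown j ++ pathUp j)
  where
  pathDown : ℕ → List Vertex
  pathDown zero    = []
  pathDown (suc t) = (i , t) ∷ []
  pathUp : ℕ → List Vertex
  pathUp t with suc t <? n
  ... | yes _ = (i , suc t) ∷ []
  ... | no  _ = []

-- Labelling functions; only the values on the vertices of the graph matter.
Labelling : Set
Labelling = Vertex → ℕ

posCount : Labelling → List Vertex → ℕ
posCount f [] = 0
posCount f (u ∷ us) with 0 <? f u
... | yes _ = suc (posCount f us)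
... | no  _ = posCount f us

IsKRDF : (k m n : ℕ) → .{{NonZero m}} → Labelling → Set
IsKRDF k m n f =
  (∀ i j → i < m → j < n → f (i , j) ≤ k + 1) ×
  (∀ i j → i < m → j < n → f (i , j) < k →
     k + posCount f (nbrs m n (i , j)) ≤ f (i , j) + sum (map f (nbrs m n (i , j))))

weight : (m n : ℕ) → Labelling → ℕ
weight m n f = sum (map f (vertices m n))

-- γ_{[k]R}(C_m □ P_n) ≤ B : since γ is the minimum weight of a [k]RDF
-- (which exists, e.g. the constant k+1 labelling), this holds iff some
-- [k]RDF has weight at most B.
γ[_]R-C_□P_≤_ : (k m n : ℕ) → .{{NonZero m}} → ℕ → Set
γ[ k ]R-C m □P n ≤ B = Σ Labelling λ f → IsKRDF k m n f × weight m n f ≤ B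

{-# OPTIONS --safe #-}
-- Give all eight vertices of row j the same label: b = ⌈(k + 3 − a)/3⌉ on the two
-- end rows and a = ⌈(k + 4)/5⌉ on the n − 2 inner rows, for weight 8(n − 2)a + 16b.
-- Every label is positive, so the [k]-Roman condition at a vertex says that the labels
-- of its closed neighbourhood sum to at least k + deg: 3b + a ≥ k + 3 on an end row and
-- x + 3a + y ≥ k + 4 on an inner row, where x, y ∈ {a, b}.  As
-- 2(x + 3a + y) = (3a + 2x) + (3a + 2y), the latter follows from 5a ≥ k + 4 and
-- 3a + 2b ≥ k + 4.
module Submission where

open import Defs
open import Data.Nat using (ℕ; zero; suc; _+_; _*_; _∸_; _≤_; _<_; NonZero; z≤n; s≤s; z<s)
open import Data.Nat.Properties
open import Data.Nat.DivMod using (_%_; m≡m%n+[m/n]*n; m%n<n; m<n*o⇒m/o<n)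
open import Data.Nat.ListAction using (sum)
open import Data.Nat.ListAction.Properties using (sum-++)
open import Data.Nat.Tactic.RingSolver using (solve-∀)
open import Data.List using (List; []; _∷_; _++_; length; map; applyUpTo; upTo; concatMap)
open import Data.List.Properties using (map-++; map-∘; length-upTo; map-upTo; applyUpTo-∷ʳ)
open import Data.Product using (_,_)
open import Relation.Binary.PropositionalEquality
open import Relation.Nullary using (yes; no; contradiction)
open import Function using (_∘_)

m≤⌈m/n⌉*n : ∀ m n .{{_ : NonZero n}} → m ≤ ⌈ m / n ⌉ * n
m≤⌈m/n⌉*n m (suc n) = +-cancelʳ-≤ n m (⌈ m / suc n ⌉ * suc n) (begin
  m + n                      ≡⟨ cong (_∸ 1) (+-suc m n) ⟨
  m + suc n ∸ 1              ≡⟨ m≡m%n+[m/n]*n (m + suc n ∸ 1) (suc n) ⟩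
  r + ⌈ m / suc n ⌉ * suc n  ≤⟨ +-monoˡ-≤ _ (≤-pred (m%n<n (m + suc n ∸ 1) (suc n))) ⟩
  n + ⌈ m / suc n ⌉ * suc n  ≡⟨ +-comm n _ ⟩
  ⌈ m / suc n ⌉ * suc n + n  ∎)
  where
  open ≤-Reasoning
  r : ℕ
  r = (m + suc n ∸ 1) % suc n

⌈m/n⌉≤o : ∀ {m n o} .{{_ : NonZero n}} → m ≤ o * n → ⌈ m / n ⌉ ≤ o
⌈m/n⌉≤o {m} {suc n} {o} m≤o*n = ≤-pred (m<n*o⇒m/o<n (begin-strict
  m + suc n ∸ 1        ≡⟨ cong (_∸ 1) (+-suc m n) ⟩
  m + n                ≤⟨ +-monoˡ-≤ n m≤o*n ⟩
  o * suc n + n        <⟨ n<1+n _ ⟩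
  suc (o * suc n + n)  ≡⟨ cong suc (+-comm _ n) ⟩
  suc o * suc n        ∎))
  where open ≤-Reasoning

0<⌈m/n⌉ : ∀ {m n} .{{_ : NonZero n}} → 0 < m → 0 < ⌈ m / n ⌉
0<⌈m/n⌉ {m} {n} 0<m with ⌈ m / n ⌉ | m≤⌈m/n⌉*n m n
... | zero  | m≤0 = contradiction m≤0 (<⇒≱ 0<m)
... | suc _ | _   = z<s

rowConstant : (ℕ → ℕ) → Labelling
rowConstant g (_ , j) = g j

posCount≡length : ∀ f (us : List Vertex) → (∀ v → 0 < f v) → posCount f us ≡ length us
posCount≡length f []       pos = refl
posCount≡length f (u ∷ us) pos with 0 <? f u
... | yes _   = cong suc (posCount≡length f us pos)
... | no  f≯0 = contradiction (pos u) f≯0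

weight-rowConstant : ∀ m n g → weight m n (rowConstant g) ≡ m * sum (map g (upTo n))
weight-rowConstant m n g = trans (columns (upTo m)) (cong (_* rowSum) (length-upTo m))
  where
  rowSum : ℕ
  rowSum = sum (map g (upTo n))
  row : ℕ → List Vertex
  row i = map (i ,_) (upTo n)
  columns : ∀ is → sum (map (rowConstant g) (concatMap row is)) ≡ length is * rowSum
  columns []       = refl
  columns (i ∷ is) = begin
    sum (map (rowConstant g) (row i ++ concatMap row is))
      ≡⟨ cong sum (map-++ (rowConstant g) (row i) _) ⟩
    sum (map (rowConstant g) (row i) ++ map (rowConstant g) (concatMap row is))
      ≡⟨ sum-++ (map (rowConstant g) (row i)) _ ⟩
    sum (map (rowConstant g) (row i)) + sum (map (rowConstant g) (concatMap row is))
      ≡⟨ cong₂ _+_ (cong sum (sym (map-∘ (upTo n)))) (columns is) ⟩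
    rowSum + length is * rowSum
      ∎
    where open ≡-Reasoning

rowConstant-isKRDF : ∀ {k m p} .{{_ : NonZero m}} (g : ℕ → ℕ) →
  (∀ j → 0 < g j) → (∀ j → g j ≤ k + 1) →
  k + 3 ≤ 3 * g 0 + g 1 →
  (∀ {j} → j < p → k + 4 ≤ g j + 3 * g (suc j) + g (2 + j)) →
  k + 3 ≤ 3 * g (suc p) + g p →
  IsKRDF k m (2 + p) (rowConstant g)
rowConstant-isKRDF {k} {m} {p} g pos bounded first inner last =
  (λ _ j _ _ → bounded j) , λ i j _ j<n _ → condition i j j<n
  where
  N : ℕ → ℕ → List Vertex
  N i j = nbrs m (2 + p) (i , j)

  end-row-sum : ∀ x y → 3 * x + y ≡ x + (x + (x + (y + 0)))
  end-row-sum = solve-∀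

  inner-row-sum : ∀ x y z → x + 3 * y + z ≡ y + (y + (y + (x + (z + 0))))
  inner-row-sum = solve-∀

  closed : ∀ i j → j < 2 + p → k + length (N i j) ≤ g j + sum (map (rowConstant g) (N i j))
  closed i zero    _   = subst (k + 3 ≤_) (end-row-sum (g 0) (g 1)) first
  closed i (suc j) j<n with suc (suc j) <? 2 + p
  ... | yes j+2<n = subst (k + 4 ≤_) (inner-row-sum (g j) (g (suc j)) (g (2 + j)))
                          (inner (≤-pred (≤-pred j+2<n)))
  ... | no  j+2≮n rewrite ≤-antisym (≤-pred (≤-pred j<n)) (≤-pred (≤-pred (≮⇒≥ j+2≮n))) =
    subst (k + 3 ≤_) (end-row-sum (g (suc p)) (g p)) last

  condition : ∀ i j → j < 2 + p →
    k + posCount (rowConstant g) (N i j) ≤ g j + sum (map (rowConstant g) (N i j))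
  condition i j j<n rewrite posCount≡length (rowConstant g) (N i j) (λ (_ , j) → pos j) =
    closed i j j<n

twoLevel : (p a b : ℕ) → ℕ → ℕ
twoLevel p a b zero = b
twoLevel p a b (suc j) with j <? p
... | yes _ = a
... | no  _ = b

twoLevel-elim : ∀ {p a b} (P : ℕ → Set) → P a → P b → ∀ j → P (twoLevel p a b j)
twoLevel-elim     P Pa Pb zero = Pb
twoLevel-elim {p} P Pa Pb (suc j) with j <? p
... | yes _ = Pa
... | no  _ = Pb

twoLevel-inner : ∀ p a b {j} → j < p → twoLevel p a b (suc j) ≡ a
twoLevel-inner p a b {j} j<p with j <? p
... | yes _   = refl
... | no  j≮p = contradiction j<p j≮p

twoLevel-last : ∀ p a b → twoLevel p a b (suc p) ≡ b
twoLevel-last p a b with p <? p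
... | yes p<p = contradiction p<p (<-irrefl refl)
... | no  _   = refl

sum-applyUpTo-const : ∀ (f : ℕ → ℕ) {c} n → (∀ {i} → i < n → f i ≡ c) →
                      sum (applyUpTo f n) ≡ n * c
sum-applyUpTo-const f zero    _   = refl
sum-applyUpTo-const f (suc n) f≡c =
  cong₂ _+_ (f≡c z<s) (sum-applyUpTo-const (f ∘ suc) n (f≡c ∘ s≤s))

sum-twoLevel : ∀ p a b → sum (map (twoLevel p a b) (upTo (2 + p))) ≡ b + (p * a + b)
sum-twoLevel p a b = begin
  sum (map g (upTo (2 + p)))
    ≡⟨ cong sum (map-upTo g (2 + p)) ⟩
  b + sum (applyUpTo (g ∘ suc) (suc p))
    ≡⟨ cong (λ xs → b + sum xs) (applyUpTo-∷ʳ (g ∘ suc) p) ⟨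
  b + sum (applyUpTo (g ∘ suc) p ++ g (suc p) ∷ [])
    ≡⟨ cong (b +_) (sum-++ (applyUpTo (g ∘ suc) p) _) ⟩
  b + (sum (applyUpTo (g ∘ suc) p) + (g (suc p) + 0))
    ≡⟨ cong (b +_) (cong₂ _+_ inner last) ⟩
  b + (p * a + b)
    ∎
  where
  open ≡-Reasoning
  g : ℕ → ℕ
  g = twoLevel p a b
  inner : sum (applyUpTo (g ∘ suc) p) ≡ p * a
  inner = sum-applyUpTo-const (g ∘ suc) p (twoLevel-inner p a b)
  last : g (suc p) + 0 ≡ b
  last = trans (+-identityʳ _) (twoLevel-last p a b)

≤-average : ∀ {c x y z} → c ≤ y + 2 * x → c ≤ y + 2 * z → c ≤ x + y + z
≤-average {c} {x} {y} {z} c≤y+2x c≤y+2z = *-cancelˡ-≤ 2 (begin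
  2 * c                    ≡⟨ cong (c +_) (+-identityʳ c) ⟩
  c + c                    ≤⟨ +-mono-≤ c≤y+2x c≤y+2z ⟩
  y + 2 * x + (y + 2 * z)  ≡⟨ regroup x y z ⟩
  2 * (x + y + z)          ∎)
  where
  open ≤-Reasoning
  regroup : ∀ x y z → y + 2 * x + (y + 2 * z) ≡ 2 * (x + y + z)
  regroup = solve-∀

twoLevel-isKRDF : ∀ {k m p a b} .{{_ : NonZero m}} → 0 < p →
  0 < a → 0 < b → a ≤ k + 1 → b ≤ k + 1 →
  k + 3 ≤ 3 * b + a → k + 4 ≤ 5 * a → k + 4 ≤ 3 * a + 2 * b →
  IsKRDF k m (2 + p) (rowConstant (twoLevel p a b))
twoLevel-isKRDF {k} {p = suc q} {a} {b} _ 0<a 0<b a≤k+1 b≤k+1 end inner-a inner-b =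
  rowConstant-isKRDF g (twoLevel-elim (0 <_) 0<a 0<b) (twoLevel-elim (_≤ k + 1) a≤k+1 b≤k+1)
    (subst (λ x → k + 3 ≤ 3 * b + x) (sym (twoLevel-inner (suc q) a b z<s)) end)
    inner
    (subst₂ (λ x y → k + 3 ≤ 3 * x + y) (sym (twoLevel-last (suc q) a b))
                                        (sym (twoLevel-inner (suc q) a b (n<1+n q))) end)
  where
  g : ℕ → ℕ
  g = twoLevel (suc q) a b
  inner : ∀ {j} → j < suc q → k + 4 ≤ g j + 3 * g (suc j) + g (2 + j)
  inner {j} j<p =
    subst (λ y → k + 4 ≤ g j + 3 * y + g (2 + j)) (sym (twoLevel-inner (suc q) a b j<p))
          (≤-average {x = g j} {y = 3 * a} {z = g (2 + j)} (around j) (around (2 + j)))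
    where
    around : ∀ i → k + 4 ≤ 3 * a + 2 * g i
    around = twoLevel-elim (λ x → k + 4 ≤ 3 * a + 2 * x)
                           (subst (k + 4 ≤_) (*-distribʳ-+ a 3 2) inner-a) inner-b

module Levels (k : ℕ) where

  a : ℕ
  a = ⌈ k + 4 / 5 ⌉

  b : ℕ
  b = ⌈ k + 3 ∸ a / 3 ⌉

  k+4≤5a : k + 4 ≤ 5 * a
  k+4≤5a = subst (k + 4 ≤_) (*-comm a 5) (m≤⌈m/n⌉*n (k + 4) 5)

  0<a : 0 < a
  0<a = 0<⌈m/n⌉ (<-≤-trans z<s (m≤n+m 4 k))

  a≤k+1 : a ≤ k + 1
  a≤k+1 = ⌈m/n⌉≤o (subst (k + 4 ≤_) (expand k) (m≤m+n (k + 4) (4 * k + 1)))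
    where
    expand : ∀ k → k + 4 + (4 * k + 1) ≡ (k + 1) * 5
    expand = solve-∀

  k+3≤3b+a : k + 3 ≤ 3 * b + a
  k+3≤3b+a = begin
    k + 3            ≤⟨ m≤n+m∸n (k + 3) a ⟩
    a + (k + 3 ∸ a)  ≤⟨ +-monoʳ-≤ a (m≤⌈m/n⌉*n (k + 3 ∸ a) 3) ⟩
    a + b * 3        ≡⟨ +-comm a (b * 3) ⟩
    b * 3 + a        ≡⟨ cong (_+ a) (*-comm b 3) ⟩
    3 * b + a        ∎
    where open ≤-Reasoning

  0<b : 0 < b
  0<b = 0<⌈m/n⌉ (m<n⇒0<n∸m (≤-<-trans a≤k+1 (+-monoʳ-< k (s≤s (s≤s z≤n)))))

  b≤k+1 : b ≤ k + 1
  b≤k+1 = ⌈m/n⌉≤o (≤-trans (m∸n≤m (k + 3) a)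
                            (subst (k + 3 ≤_) (expand k) (m≤m+n (k + 3) (2 * k))))
    where
    expand : ∀ k → k + 3 + 2 * k ≡ (k + 1) * 3
    expand = solve-∀

  k+4≤3a+2b : k + 4 ≤ 3 * a + 2 * b
  k+4≤3a+2b = *-cancelˡ-≤ 3 (begin
    3 * (k + 4)                      ≡⟨ split k ⟩
    2 * (k + 3) + (k + 4) + 2 * 1    ≤⟨ +-mono-≤ (+-mono-≤ (*-monoʳ-≤ 2 k+3≤3b+a) k+4≤5a)
                                                (*-monoʳ-≤ 2 0<a) ⟩
    2 * (3 * b + a) + 5 * a + 2 * a  ≡⟨ merge a b ⟩
    3 * (3 * a + 2 * b)              ∎)
    where
    open ≤-Reasoning
    split : ∀ k → 3 * (k + 4) ≡ 2 * (k + 3) + (k + 4) + 2 * 1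
    split = solve-∀
    merge : ∀ a b → 2 * (3 * b + a) + 5 * a + 2 * a ≡ 3 * (3 * a + 2 * b)
    merge = solve-∀

theorem20 : (n k : ℕ) → 4 ≤ n → 1 ≤ k →
    γ[ k ]R-C 8 □P n ≤ (8 * (n ∸ 2) * ⌈ k + 4 / 5 ⌉ + 16 * ⌈ k + 3 ∸ ⌈ k + 4 / 5 ⌉ / 3 ⌉)
-- The construction needs only n ≥ 3 and also works for k = 0, so 1 ≤ k is unused.
theorem20 (suc (suc p)) k (s≤s (s≤s 2≤p)) _ =
  rowConstant g ,
  twoLevel-isKRDF (≤-trans (s≤s z≤n) 2≤p) 0<a 0<b a≤k+1 b≤k+1 k+3≤3b+a k+4≤5a k+4≤3a+2b ,
  ≤-reflexive (begin
    weight 8 (2 + p) (rowConstant g)   ≡⟨ weight-rowConstant 8 (2 + p) g ⟩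
    8 * sum (map g (upTo (2 + p)))     ≡⟨ cong (8 *_) (sum-twoLevel p a b) ⟩
    8 * (b + (p * a + b))              ≡⟨ regroup p a b ⟩
    8 * p * a + 16 * b                 ∎)
  where
  open Levels k
  open ≡-Reasoning
  g : ℕ → ℕ
  g = twoLevel p a b
  regroup : ∀ p a b → 8 * (b + (p * a + b)) ≡ 8 * p * a + 16 * b
  regroup = solve-∀
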